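{- Let $r,s,t\ge 2$ be integers and let $(x,y,z)$ be positive integers with $\gcd(x,y,z)=1$ and $x^r+y^s=z^t$. Put $a=x^r$, $b=y^s$, $c=z^t$, $N=abc/\gcd(16,abc)$, $h=\log N$, $u_0=\min\{r,s,t\}$, $r'=\min\{r,s\}$, $s'=\max\{r,s\}$. Let $S$ be a finite set of primes, all $\ge 11$, with $|S|\ge 2$. Put $A=\{p\in S: p\mid N\}$, $B=\{p\text{ prime}: p\mid N,\ \exists\, l\in S,\ l\mid v_p(N)\}$, $C=\{p \text{ prime}: p\mid N,\ p\notin A\cup B\}$, $N_C=\prod_{p\in C}p^{v_p(N)}$ and $h_C=\log N_C$ (so $0\le h_C\le h$). Then: (i) $\log\mathrm{rad}(N_C)\le \frac{1}{u_0}h_C+\frac{4\log 2}{u_0}$. (ii) If $t\le r'$, then $\log\mathrm{rad}(N_C)\le \frac{1}{r'}(h_C-h)+\big(\frac1{2t}+\frac1{2r'}\big)h+\frac{4\log2}{u_0}$. (iii) If $t=r'$, then $\log\mathrm{rad}(N_C)\le \frac{1}{s'}(h_C-h)+\big(\frac1t+\frac1{s'}\big)\frac{2th}{3t-1}+\frac{4\log2}{u_0}$. (iv) If $t\ge r'$, then $\log\mathrm{rad}(N_C)\le \frac1t(h_C-h)+\max\big\{\frac1{2t}+\frac1{2r'},\ \frac13\big(\frac1r+\frac1s+\frac1t\big)\big\}h+\frac{4\log 2}{u_0}$.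
   Context: $v_p$ is the $p$-adic valuation, $\mathrm{rad}(m)$ the product of distinct primes dividing $m$, $\log$ the natural logarithm. -}

module Defs where

open import Data.Nat using (ℕ; zero; suc; _^_; _*_)
open import Data.Nat.Divisibility using (_∣_; _∣?_; quotient)
open import Data.Nat.GCD using (gcd; gcd[m,n]∣n)
open import Data.Nat.Primality using (Prime; prime?)
open import Data.List using (List; upTo; filter; map)
open import Data.Nat.ListAction using (product)
open import Data.List.Relation.Unary.Any using (Any; any?)
open import Data.List.Membership.Propositional using (_∈_)
open import Data.List.Membership.DecPropositional Data.Nat._≟_ using (_∈?_)
open import Data.Product using (_×_)
open import Relation.Nullary using (¬_; Dec; yes; no)
open import Relation.Nullary.Decidable using (_×-dec_; ¬?)

-- p-adic valuation: the largest k ≤ n with p ^ k ∣ n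
-- (for p ≥ 2 and n ≥ 1 this is exactly v_p(n), since v_p(n) < n)
vpGo : ℕ → ℕ → ℕ → ℕ
vpGo p n zero = zero
vpGo p n (suc k) with (p ^ suc k) ∣? n
... | yes _ = suc k
... | no _ = vpGo p n k

v : ℕ → ℕ → ℕ
v p n = vpGo p n n

-- primes dividing m (all lie in [0, m] when m ≥ 1)
primeDivisors : ℕ → List ℕ
primeDivisors m = filter (λ p → prime? p ×-dec (p ∣? m)) (upTo (suc m))

rad : ℕ → ℕ
rad m = product (primeDivisors m)

Nof : ℕ → ℕ
Nof m = quotient (gcd[m,n]∣n 16 m)

InA : List ℕ → ℕ → ℕ → Set
InA S N p = p ∈ S × p ∣ N

InB : List ℕ → ℕ → ℕ → Set
InB S N p = Prime p × p ∣ N × Any (λ l → l ∣ v p N) S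

InC : List ℕ → ℕ → ℕ → Set
InC S N p = Prime p × p ∣ N × ¬ InA S N p × ¬ InB S N p

InC? : ∀ S N p → Dec (InC S N p)
InC? S N p = prime? p ×-dec (p ∣? N) ×-dec ¬? ((p ∈? S) ×-dec (p ∣? N))
  ×-dec ¬? (prime? p ×-dec (p ∣? N) ×-dec any? (λ l → l ∣? v p N) S)

-- the primes of C (all ≤ N when N ≥ 1)
Cset : List ℕ → ℕ → List ℕ
Cset S N = filter (InC? S N) (upTo (suc N))

NC : List ℕ → ℕ → ℕ
NC S N = product (map (λ p → p ^ v p N) (Cset S N))

-- Sort the primes q of rad(N_C) by the first of x, y, z that q divides (each divides N, hence xyz):
-- rad(N_C) = pa·pb·pc with pa ∣ x, pb ∣ y, pc ∣ z, so pa^r ≤ a, pb^s ≤ b and pc^t ≤ c.  As q ∈ C, the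
-- whole q-part q^(v_q N) of N lies in N_C, so the power q^r, q^s or q^t dividing abc ∣ 16N divides 16·N_C;
-- hence pa^r·pb^s·pc^t ≤ 16·N_C.  With the logarithms exponentiated away, each of (i)–(iv) follows by
-- writing rad(N_C)^E = pa^E·pb^E·pc^E, spending K factors pa^r·pb^s·pc^t ≤ 16·N_C, and bounding the
-- leftover powers of pa^r, pb^s, pc^t by a power of abc ≤ 16N, using c² ≤ 2abc (as c = a + b) and, in
-- (iii), c^(t-1) ≤ b^t (as z^t - x^t ≥ z^(t-1)).

module Submission where

open import Defs
open import Data.Nat using (ℕ; _+_; _*_; _^_; _∸_; _≤_; _⊔_; _⊓_)
open import Data.Nat.GCD using (gcd)
open import Data.Nat.Primality using (Prime)
open import Data.List using (List; length)
open import Data.List.Relation.Unary.All using (All)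
open import Data.List.Relation.Unary.Unique.Propositional using (Unique)
open import Data.Product using (_×_)
open import Relation.Binary.PropositionalEquality using (_≡_)

open import Data.Nat
open import Data.Nat.Properties
open import Data.Nat.Divisibility
open import Data.Nat.Primality
open import Data.Nat.GCD using (gcd[m,n]∣m; gcd[m,n]∣n)
open import Data.Nat.ListAction using (product)
open import Data.Nat.ListAction.Properties using (∈⇒∣product)
open import Data.Nat.Tactic.RingSolver using (solve-∀)
open import Data.List using ([]; _∷_; map; filter; upTo)
open import Data.List.Properties using (map-id)
open import Data.List.Relation.Unary.All as All using ([]; _∷_; lookup)
open import Data.List.Relation.Unary.All.Properties using (all-filter; filter⁺)
open import Data.List.Relation.Unary.Any using (here; there)
open import Data.List.Relation.Unary.AllPairs using (_∷_)
import Data.List.Relation.Unary.Unique.Propositional.Properties as Unique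
open import Data.List.Membership.Propositional using (_∈_)
open import Data.List.Membership.Propositional.Properties using (∈-map⁺)
open import Data.Product using (_,_; proj₁; proj₂)
open import Data.Sum using (inj₁; inj₂; [_,_]′)
open import Data.Empty using (⊥-elim)
open import Function using (_∘_; id)
open import Level using (0ℓ)
open import Relation.Nullary using (¬_; yes; no)
open import Relation.Nullary.Decidable using (¬?; _×-dec_)
open import Relation.Unary using (Pred; Decidable)
open import Relation.Binary.PropositionalEquality
open import Algebra.Properties.CommutativeSemigroup *-commutativeSemigroup
  using () renaming (interchange to *-interchange; x∙yz≈y∙xz to *-exchangeˡ; xy∙z≈xz∙y to *-right-comm)

^-distribʳ-* : ∀ m n k → (m * n) ^ k ≡ m ^ k * n ^ k
^-distribʳ-* m n zero = refl
^-distribʳ-* m n (suc k) rewrite ^-distribʳ-* m n k = *-interchange m n (m ^ k) (n ^ k)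

^-distribʳ-*³ : ∀ a b c n → (a * b * c) ^ n ≡ a ^ n * b ^ n * c ^ n
^-distribʳ-*³ a b c n = trans (^-distribʳ-* (a * b) c n) (cong (_* c ^ n) (^-distribʳ-* a b n))

^-monoʳ-≤′ : ∀ m {i j} → 1 ≤ m → i ≤ j → m ^ i ≤ m ^ j
^-monoʳ-≤′ m 1≤m = ^-monoʳ-≤ m {{>-nonZero 1≤m}}

1≤m^n : ∀ m n → 1 ≤ m → 1 ≤ m ^ n
1≤m^n m n 1≤m = m^n>0 m {{>-nonZero 1≤m}} n

prime⇒≢1 : ∀ {p} → Prime p → p ≢ 1
prime⇒≢1 pp refl = ¬prime[1] pp

prime∣m^n⇒prime∣m : ∀ {p} m n → Prime p → p ∣ m ^ n → p ∣ m
prime∣m^n⇒prime∣m m zero    pp p∣1 = ⊥-elim (prime⇒≢1 pp (∣1⇒≡1 p∣1))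
prime∣m^n⇒prime∣m m (suc n) pp p∣m^n with euclidsLemma m (m ^ n) pp p∣m^n
... | inj₁ p∣m   = p∣m
... | inj₂ p∣m^n = prime∣m^n⇒prime∣m m n pp p∣m^n

^-monoˡ-∣ : ∀ {m n} k → m ∣ n → m ^ k ∣ n ^ k
^-monoˡ-∣ zero    _   = ∣-refl
^-monoˡ-∣ (suc k) m∣n = *-pres-∣ m∣n (^-monoˡ-∣ k m∣n)

prime^∣*-cancelˡ : ∀ {p m} k n → Prime p → ¬ p ∣ m → p ^ k ∣ m * n → p ^ k ∣ n
prime^∣*-cancelˡ         zero    n _  _   _ = 1∣ n
prime^∣*-cancelˡ {p} {m} (suc k) n pp p∤m p^k+1∣mn
  with euclidsLemma m n pp (∣-trans (m∣m*n (p ^ k)) p^k+1∣mn)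
... | inj₁ p∣m              = ⊥-elim (p∤m p∣m)
... | inj₂ (divides n′ refl) = subst (p ^ suc k ∣_) (*-comm p n′) (*-monoʳ-∣ p p^k∣n′)
  where
  instance _ = prime⇒nonZero pp
  p^k∣n′ : p ^ k ∣ n′
  p^k∣n′ = prime^∣*-cancelˡ k n′ pp p∤m
    (*-cancelˡ-∣ p (subst (p * p ^ k ∣_) (trans (cong (m *_) (*-comm n′ p)) (*-exchangeˡ m p n′)) p^k+1∣mn))

n<2^n : ∀ n → n < 2 ^ n
n<2^n zero    = z<s
n<2^n (suc n) = subst (suc (suc n) ≤_) (cong (2 ^ n +_) (sym (+-identityʳ (2 ^ n))))
  (+-mono-≤ (m^n>0 2 n) (n<2^n n))

vpGo-∣ : ∀ p n K → p ^ vpGo p n K ∣ n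
vpGo-∣ p n zero = 1∣ n
vpGo-∣ p n (suc K) with p ^ suc K ∣? n
... | yes p^K+1∣n = p^K+1∣n
... | no  _       = vpGo-∣ p n K

vpGo-maximal : ∀ p n K j → p ^ j ∣ n → j ≤ K → j ≤ vpGo p n K
vpGo-maximal p n zero    j _     j≤0 = j≤0
vpGo-maximal p n (suc K) j p^j∣n j≤K+1 with p ^ suc K ∣? n
... | yes _ = j≤K+1
... | no  p^K+1∤n with j ≟ suc K
...   | yes refl = ⊥-elim (p^K+1∤n p^j∣n)
...   | no  j≢K+1 = vpGo-maximal p n K j p^j∣n (≤-pred (≤∧≢⇒< j≤K+1 j≢K+1))

p^v∣n : ∀ p n → p ^ v p n ∣ n
p^v∣n p n = vpGo-∣ p n n

-- The search bound n suffices: j < 2 ^ j ≤ p ^ j ≤ n.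
p^j∣n⇒j≤v : ∀ {p n j} → Prime p → 1 ≤ n → p ^ j ∣ n → j ≤ v p n
p^j∣n⇒j≤v {p} {n@(suc _)} {j} pp _ p^j∣n = vpGo-maximal p n n j p^j∣n (<⇒≤ (begin-strict
  j       <⟨ n<2^n j ⟩
  2 ^ j   ≤⟨ ^-monoˡ-≤ j (nonTrivial⇒n>1 p {{prime⇒nonTrivial pp}}) ⟩
  p ^ j   ≤⟨ ∣⇒≤ p^j∣n ⟩
  n       ∎))
  where open ≤-Reasoning

p^j∣n*m⇒p^j∣p^v*m : ∀ {p n j} m → Prime p → 1 ≤ n → p ^ j ∣ n * m → p ^ j ∣ p ^ v p n * m
p^j∣n*m⇒p^j∣p^v*m {p} {n} {j} m pp 1≤n p^j∣nm with p^v∣n p n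
... | divides n′ n≡n′p^v = prime^∣*-cancelˡ j (p ^ v p n * m) pp p∤n′
  (subst (p ^ j ∣_) (trans (cong (_* m) n≡n′p^v) (*-assoc n′ (p ^ v p n) m)) p^j∣nm)
  where
  p∤n′ : ¬ p ∣ n′
  p∤n′ p∣n′ = 1+n≰n (p^j∣n⇒j≤v pp 1≤n (subst (p ^ suc (v p n) ∣_) (sym n≡n′p^v)
    (*-monoˡ-∣ (p ^ v p n) p∣n′)))

product-map-^ : ∀ k L → product (map (_^ k) L) ≡ product L ^ k
product-map-^ k []      = sym (^-zeroˡ k)
product-map-^ k (p ∷ L) = trans (cong (p ^ k *_) (product-map-^ k L)) (sym (^-distribʳ-* p (product L) k))

product-map-cong : ∀ {f g : ℕ → ℕ} {L} → All (λ q → f q ≡ g q) L → product (map f L) ≡ product (map g L)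
product-map-cong []           = refl
product-map-cong (fq≡gq ∷ eq) = cong₂ _*_ fq≡gq (product-map-cong eq)

product-map-filter : ∀ {P : Pred ℕ 0ℓ} (P? : Decidable P) f L →
  product (map f L) ≡ product (map f (filter P? L)) * product (map f (filter (¬? ∘ P?) L))
product-map-filter P? f []      = refl
product-map-filter P? f (q ∷ L) with P? q
... | yes _ = trans (cong (f q *_) (product-map-filter P? f L))
  (sym (*-assoc (f q) (product (map f (filter P? L))) (product (map f (filter (¬? ∘ P?) L)))))
... | no  _ = trans (cong (f q *_) (product-map-filter P? f L))
  (*-exchangeˡ (f q) (product (map f (filter P? L))) (product (map f (filter (¬? ∘ P?) L))))

product-filter : ∀ {P : Pred ℕ 0ℓ} (P? : Decidable P) L →
  product L ≡ product (filter P? L) * product (filter (¬? ∘ P?) L)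
product-filter P? L = begin
  product L                                                ≡⟨ product-map-id L ⟨
  product (map id L)                                       ≡⟨ product-map-filter P? id L ⟩
  product (map id (filter P? L)) * product (map id (filter (¬? ∘ P?) L))
                                                           ≡⟨ cong₂ _*_ (product-map-id (filter P? L)) (product-map-id (filter (¬? ∘ P?) L)) ⟩
  product (filter P? L) * product (filter (¬? ∘ P?) L)     ∎
  where
  open ≡-Reasoning
  product-map-id : ∀ L → product (map id L) ≡ product L
  product-map-id L = cong product (map-id L)

module _ (e : ℕ → ℕ) where

  1≤∏p^e : ∀ L → All Prime L → 1 ≤ product (map (λ p → p ^ e p) L)
  1≤∏p^e []      []        = ≤-refl
  1≤∏p^e (p ∷ L) (pp ∷ ps) = *-mono-≤ (m^n>0 p {{prime⇒nonZero pp}} (e p)) (1≤∏p^e L ps)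

  prime∣∏p^e⇒∈ : ∀ {q} L → Prime q → All Prime L → q ∣ product (map (λ p → p ^ e p) L) → q ∈ L
  prime∣∏p^e⇒∈ []      pq _         q∣1 = ⊥-elim (prime⇒≢1 pq (∣1⇒≡1 q∣1))
  prime∣∏p^e⇒∈ (p ∷ L) pq (pp ∷ ps) q∣∏ with euclidsLemma (p ^ e p) _ pq q∣∏
  ... | inj₂ q∣∏L  = there (prime∣∏p^e⇒∈ L pq ps q∣∏L)
  ... | inj₁ q∣p^e with prime⇒irreducible pp (prime∣m^n⇒prime∣m p (e p) pq q∣p^e)
  ...   | inj₁ q≡1 = ⊥-elim (prime⇒≢1 pq q≡1)
  ...   | inj₂ q≡p = here q≡p

  ∏p^e-∣ : ∀ {M} L → Unique L → All Prime L → All (λ q → q ^ e q ∣ M) L →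
           product (map (λ q → q ^ e q) L) ∣ M
  ∏p^e-∣ {M} []      _           _         _ = 1∣ M
  ∏p^e-∣ {M} (q ∷ L) (q∉L ∷ uL) (pq ∷ ps) (q^e∣M ∷ ds) with ∏p^e-∣ L uL ps ds
  ... | divides m ∏≡ = subst (q ^ e q * ∏L ∣_) (sym ∏≡) (*-monoˡ-∣ ∏L q^e∣m)
    where
    ∏L : ℕ
    ∏L = product (map (λ q → q ^ e q) L)
    q∤∏L : ¬ q ∣ ∏L
    q∤∏L q∣∏L = lookup q∉L (prime∣∏p^e⇒∈ L pq ps q∣∏L) refl
    q^e∣m : q ^ e q ∣ m
    q^e∣m = prime^∣*-cancelˡ (e q) m pq q∤∏L (subst (q ^ e q ∣_) (trans ∏≡ (*-comm m ∏L)) q^e∣M)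

∏-primes-∣ : ∀ {M} L → Unique L → All Prime L → All (_∣ M) L → product L ∣ M
∏-primes-∣ {M} L uL ps ds = subst (_∣ M) (trans (product-map-^ 1 L) (^-identityʳ (product L)))
  (∏p^e-∣ (λ _ → 1) L uL ps (All.map (λ {q} q∣M → subst (_∣ M) (sym (^-identityʳ q)) q∣M) ds))

primeDivisors-prime∣ : ∀ m → All (λ q → Prime q × q ∣ m) (primeDivisors m)
primeDivisors-prime∣ m = all-filter (λ p → prime? p ×-dec (p ∣? m)) (upTo (suc m))

primeDivisors-unique : ∀ m → Unique (primeDivisors m)
primeDivisors-unique m = Unique.filter⁺ (λ p → prime? p ×-dec (p ∣? m)) (Unique.upTo⁺ (suc m))

Cset-InC : ∀ S N → All (InC S N) (Cset S N)
Cset-InC S N = all-filter (InC? S N) (upTo (suc N))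

prime∣NC⇒∈Cset : ∀ S N {q} → Prime q → q ∣ NC S N → q ∈ Cset S N
prime∣NC⇒∈Cset S N pq q∣NC = prime∣∏p^e⇒∈ (λ p → v p N) (Cset S N) pq (All.map proj₁ (Cset-InC S N)) q∣NC

prime∣NC⇒prime∣N : ∀ S N {q} → Prime q → q ∣ NC S N → q ∣ N
prime∣NC⇒prime∣N S N pq q∣NC = proj₁ (proj₂ (lookup (Cset-InC S N) (prime∣NC⇒∈Cset S N pq q∣NC)))

prime^∣N*16⇒prime^∣NC*16 : ∀ S N {q j} → Prime q → q ∣ NC S N → 1 ≤ N → q ^ j ∣ N * 16 → q ^ j ∣ NC S N * 16
prime^∣N*16⇒prime^∣NC*16 S N {q} {j} pq q∣NC 1≤N q^j∣16N = ∣-trans (p^j∣n*m⇒p^j∣p^v*m {j = j} 16 pq 1≤N q^j∣16N)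
  (*-monoˡ-∣ 16 (∈⇒∣product (∈-map⁺ (λ p → p ^ v p N) (prime∣NC⇒∈Cset S N pq q∣NC))))

^-split-≤ : ∀ p {e K L E} → 1 ≤ p → E ≤ e * (K + L) → p ^ E ≤ (p ^ e) ^ K * (p ^ e) ^ L
^-split-≤ p {e} {K} {L} {E} 1≤p E≤ = begin
  p ^ E                     ≤⟨ ^-monoʳ-≤′ p 1≤p E≤ ⟩
  p ^ (e * (K + L))         ≡⟨ cong (p ^_) (*-distribˡ-+ e K L) ⟩
  p ^ (e * K + e * L)       ≡⟨ ^-distribˡ-+-* p (e * K) (e * L) ⟩
  p ^ (e * K) * p ^ (e * L) ≡⟨ cong₂ _*_ (^-*-assoc p e K) (^-*-assoc p e L) ⟨
  (p ^ e) ^ K * (p ^ e) ^ L ∎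
  where open ≤-Reasoning

^-*-bound : ∀ k a b c d e {R N C} → R ^ a * N ^ b ≤ C ^ c * N ^ d * 2 ^ e →
  R ^ (a * k) * N ^ (b * k) ≤ C ^ (c * k) * N ^ (d * k) * 2 ^ (e * k)
^-*-bound k a b c d e {R} {N} {C} bound = begin
  R ^ (a * k) * N ^ (b * k)                   ≡⟨ cong₂ _*_ (^-*-assoc R a k) (^-*-assoc N b k) ⟨
  (R ^ a) ^ k * (N ^ b) ^ k                   ≡⟨ ^-distribʳ-* (R ^ a) (N ^ b) k ⟨
  (R ^ a * N ^ b) ^ k                         ≤⟨ ^-monoˡ-≤ k bound ⟩
  (C ^ c * N ^ d * 2 ^ e) ^ k                 ≡⟨ ^-distribʳ-* (C ^ c * N ^ d) (2 ^ e) k ⟩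
  (C ^ c * N ^ d) ^ k * (2 ^ e) ^ k           ≡⟨ cong (_* (2 ^ e) ^ k) (^-distribʳ-* (C ^ c) (N ^ d) k) ⟩
  (C ^ c) ^ k * (N ^ d) ^ k * (2 ^ e) ^ k     ≡⟨ cong₂ _*_ (cong₂ _*_ (^-*-assoc C c k) (^-*-assoc N d k)) (^-*-assoc 2 e k) ⟩
  C ^ (c * k) * N ^ (d * k) * 2 ^ (e * k)     ∎
  where open ≤-Reasoning

bound-weaken : ∀ c {X C N d d′ e e′} → 1 ≤ N → d ≤ d′ → e ≤ e′ →
  X ≤ C ^ c * N ^ d * 2 ^ e → X ≤ C ^ c * N ^ d′ * 2 ^ e′
bound-weaken c {C = C} {N} 1≤N d≤d′ e≤e′ bound = ≤-trans bound
  (*-mono-≤ (*-monoʳ-≤ (C ^ c) (^-monoʳ-≤′ N 1≤N d≤d′)) (^-monoʳ-≤ 2 e≤e′))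

c*c≤2*abc : ∀ {a b c} → a + b ≡ c → 1 ≤ a → 1 ≤ b → c * c ≤ 2 * (a * b * c)
c*c≤2*abc {a} {b} {c} a+b≡c 1≤a 1≤b = begin
  c * c                 ≡⟨ cong (c *_) a+b≡c ⟨
  c * (a + b)           ≤⟨ *-monoʳ-≤ c (+-mono-≤ a≤ab b≤ab) ⟩
  c * (a * b + a * b)   ≡⟨ rearrange a b c ⟩
  2 * (a * b * c)       ∎
  where
  open ≤-Reasoning
  a≤ab : a ≤ a * b
  a≤ab = ≤-trans (≤-reflexive (sym (*-identityʳ a))) (*-monoʳ-≤ a 1≤b)
  b≤ab : b ≤ a * b
  b≤ab = ≤-trans (≤-reflexive (sym (*-identityˡ b))) (*-monoˡ-≤ b 1≤a)
  rearrange : ∀ a b c → c * (a * b + a * b) ≡ 2 * (a * b * c)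
  rearrange = solve-∀

power-gap : ∀ {x z b} t → 1 ≤ b → x ^ suc t + b ≡ z ^ suc t → z ^ t ≤ b
power-gap {x} {z} {b} t 1≤b eq with z ≤? x
... | yes z≤x = ⊥-elim (<⇒≱ 1≤b (+-cancelˡ-≤ (x ^ suc t) b 0 (begin
  x ^ suc t + b  ≡⟨ eq ⟩
  z ^ suc t      ≤⟨ ^-monoˡ-≤ (suc t) z≤x ⟩
  x ^ suc t      ≡⟨ +-identityʳ (x ^ suc t) ⟨
  x ^ suc t + 0  ∎)))
  where open ≤-Reasoning
... | no z≰x = +-cancelˡ-≤ (x ^ suc t) (z ^ t) b (begin
  x ^ suc t + z ^ t     ≤⟨ +-monoˡ-≤ (z ^ t) (*-monoʳ-≤ x (^-monoˡ-≤ t (<⇒≤ x<z))) ⟩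
  x * z ^ t + z ^ t     ≡⟨ +-comm (x * z ^ t) (z ^ t) ⟩
  suc x * z ^ t         ≤⟨ *-monoˡ-≤ (z ^ t) x<z ⟩
  z ^ suc t             ≡⟨ eq ⟨
  x ^ suc t + b         ∎)
  where
  open ≤-Reasoning
  x<z : x < z
  x<z = ≰⇒> z≰x

power-gap-^ : ∀ {x z b} t → 1 ≤ t → 1 ≤ b → x ^ t + b ≡ z ^ t → (z ^ t) ^ (t ∸ 1) ≤ b ^ t
power-gap-^ {x} {z} {b} (suc t) _ 1≤b eq = begin
  (z ^ suc t) ^ t   ≡⟨ ^-*-assoc z (suc t) t ⟩
  z ^ (suc t * t)   ≡⟨ cong (z ^_) (*-comm (suc t) t) ⟩
  z ^ (t * suc t)   ≡⟨ ^-*-assoc z t (suc t) ⟨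
  (z ^ t) ^ suc t   ≤⟨ ^-monoˡ-≤ (suc t) (power-gap {x} t 1≤b eq) ⟩
  b ^ suc t         ∎
  where open ≤-Reasoning

[ac]^[2m+k]≤[abc]^2m : ∀ {a b c} m k → a ≤ c → c ^ k ≤ b ^ m →
  (a * c) ^ (2 * m + k) ≤ (a * b * c) ^ (2 * m)
[ac]^[2m+k]≤[abc]^2m {a} {b} {c} m k a≤c c^k≤b^m = begin
  (a * c) ^ (2 * m + k)                 ≡⟨ ^-distribˡ-+-* (a * c) (2 * m) k ⟩
  (a * c) ^ (2 * m) * (a * c) ^ k       ≡⟨ cong ((a * c) ^ (2 * m) *_) (^-distribʳ-* a c k) ⟩
  (a * c) ^ (2 * m) * (a ^ k * c ^ k)   ≤⟨ *-monoʳ-≤ ((a * c) ^ (2 * m)) (*-mono-≤ a^k≤b^m c^k≤b^m) ⟩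
  (a * c) ^ (2 * m) * (b ^ m * b ^ m)   ≡⟨ cong ((a * c) ^ (2 * m) *_) b^m*b^m≡b^2m ⟩
  (a * c) ^ (2 * m) * b ^ (2 * m)       ≡⟨ ^-distribʳ-* (a * c) b (2 * m) ⟨
  (a * c * b) ^ (2 * m)                 ≡⟨ cong (_^ (2 * m)) (*-right-comm a c b) ⟩
  (a * b * c) ^ (2 * m)                 ∎
  where
  open ≤-Reasoning
  a^k≤b^m : a ^ k ≤ b ^ m
  a^k≤b^m = ≤-trans (^-monoˡ-≤ k a≤c) c^k≤b^m
  b^m*b^m≡b^2m : b ^ m * b ^ m ≡ b ^ (2 * m)
  b^m*b^m≡b^2m = trans (sym (^-distribˡ-+-* b m m)) (cong (b ^_) (cong (m +_) (sym (+-identityʳ m))))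

a^[n+n]*b^m≤[abc]^n : ∀ {a b c} n m → a ≤ c → 1 ≤ b → m ≤ n →
  a ^ (n + n) * b ^ m ≤ (a * b * c) ^ n
a^[n+n]*b^m≤[abc]^n {a} {b} {c} n m a≤c 1≤b m≤n = begin
  a ^ (n + n) * b ^ m       ≡⟨ cong (_* b ^ m) (^-distribˡ-+-* a n n) ⟩
  a ^ n * a ^ n * b ^ m     ≤⟨ *-mono-≤ (*-monoʳ-≤ (a ^ n) (^-monoˡ-≤ n a≤c)) (^-monoʳ-≤′ b 1≤b m≤n) ⟩
  a ^ n * c ^ n * b ^ n     ≡⟨ *-right-comm (a ^ n) (c ^ n) (b ^ n) ⟩
  a ^ n * b ^ n * c ^ n     ≡⟨ ^-distribʳ-*³ a b c n ⟨
  (a * b * c) ^ n           ∎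
  where open ≤-Reasoning

a^[n+i]*b^[n+j]≤[abc]^n : ∀ {a b c} n i j → a ≤ c → b ≤ c → i + j ≡ n →
  a ^ (n + i) * b ^ (n + j) ≤ (a * b * c) ^ n
a^[n+i]*b^[n+j]≤[abc]^n {a} {b} {c} n i j a≤c b≤c i+j≡n = begin
  a ^ (n + i) * b ^ (n + j)           ≡⟨ cong₂ _*_ (^-distribˡ-+-* a n i) (^-distribˡ-+-* b n j) ⟩
  a ^ n * a ^ i * (b ^ n * b ^ j)     ≤⟨ *-mono-≤ (*-monoʳ-≤ (a ^ n) (^-monoˡ-≤ i a≤c)) (*-monoʳ-≤ (b ^ n) (^-monoˡ-≤ j b≤c)) ⟩
  a ^ n * c ^ i * (b ^ n * c ^ j)     ≡⟨ *-interchange (a ^ n) (c ^ i) (b ^ n) (c ^ j) ⟩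
  a ^ n * b ^ n * (c ^ i * c ^ j)     ≡⟨ cong (a ^ n * b ^ n *_) (trans (sym (^-distribˡ-+-* c i j)) (cong (c ^_) i+j≡n)) ⟩
  a ^ n * b ^ n * c ^ n               ≡⟨ ^-distribʳ-*³ a b c n ⟨
  (a * b * c) ^ n                     ∎
  where open ≤-Reasoning

3*t∸1≡2*t+[t∸1] : ∀ t → 1 ≤ t → 3 * t ∸ 1 ≡ 2 * t + (t ∸ 1)
3*t∸1≡2*t+[t∸1] (suc t) _ = +-comm t (2 * suc t)

a^3x*b^3y≤[abc]^[x+y] : ∀ {a b c} x y → a ≤ c → b ≤ c → y ≤ 2 * x → x ≤ 2 * y →
  a ^ (3 * x) * b ^ (3 * y) ≤ (a * b * c) ^ (x + y)
a^3x*b^3y≤[abc]^[x+y] {a} {b} {c} x y a≤c b≤c y≤2x x≤2y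
  with m≤n⇒∃[o]m+o≡n y≤2x | m≤n⇒∃[o]m+o≡n x≤2y
... | i , y+i≡2x | j , x+j≡2y =
  subst₂ (λ e f → a ^ e * b ^ f ≤ (a * b * c) ^ (x + y)) x+y+i≡3x x+y+j≡3y
    (a^[n+i]*b^[n+j]≤[abc]^n (x + y) i j a≤c b≤c i+j≡x+y)
  where
  x+y+i≡3x : x + y + i ≡ 3 * x
  x+y+i≡3x = trans (+-assoc x y i) (cong (x +_) y+i≡2x)
  x+y+j≡3y : x + y + j ≡ 3 * y
  x+y+j≡3y = trans (trans (cong (_+ j) (+-comm x y)) (+-assoc y x j)) (cong (y +_) x+j≡2y)
  i+j≡x+y : i + j ≡ x + y
  i+j≡x+y = +-cancelˡ-≡ (x + y) (i + j) (x + y) (begin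
    x + y + (i + j)     ≡⟨ regroup x y i j ⟩
    (y + i) + (x + j)   ≡⟨ cong₂ _+_ y+i≡2x x+j≡2y ⟩
    2 * x + 2 * y       ≡⟨ double x y ⟩
    x + y + (x + y)     ∎)
    where
    open ≡-Reasoning
    regroup : ∀ x y i j → x + y + (i + j) ≡ (y + i) + (x + j)
    regroup = solve-∀
    double : ∀ x y → 2 * x + 2 * y ≡ x + y + (x + y)
    double = solve-∀

-- The bounds (i)–(iv), given a splitting of the radical

BoundI : (r′ t R C : ℕ) → Set
BoundI r′ t R C = R ^ (r′ ⊓ t) ≤ C * 2 ^ 4

BoundII : (r′ t R N C : ℕ) → Set
BoundII r′ t R N C = t ≤ r′ → R ^ (2 * t * r′ * (r′ ⊓ t)) * N ^ (2 * t * (r′ ⊓ t))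
  ≤ C ^ (2 * t * (r′ ⊓ t)) * N ^ ((r′ + t) * (r′ ⊓ t)) * 2 ^ (8 * t * r′)

BoundIII : (r′ s′ t R N C : ℕ) → Set
BoundIII r′ s′ t R N C = t ≡ r′ → R ^ (s′ * t * (3 * t ∸ 1) * (r′ ⊓ t)) * N ^ (t * (3 * t ∸ 1) * (r′ ⊓ t))
  ≤ C ^ (t * (3 * t ∸ 1) * (r′ ⊓ t)) * N ^ (2 * t * (s′ + t) * (r′ ⊓ t)) * 2 ^ (4 * s′ * t * (3 * t ∸ 1))

-- (iv) depends on r and s only through the symmetric quantities ρ₆ = 6rs, ρ₃ = 3rs, ρ₂₄ = 24rs, σ = st + rt + rs.
BoundIV : (ρ₆ ρ₃ ρ₂₄ σ r′ t R N C : ℕ) → Set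
BoundIV ρ₆ ρ₃ ρ₂₄ σ r′ t R N C = r′ ≤ t → R ^ (ρ₆ * t * r′ * (r′ ⊓ t)) * N ^ (ρ₆ * r′ * (r′ ⊓ t))
  ≤ C ^ (ρ₆ * r′ * (r′ ⊓ t)) * N ^ ((ρ₃ * (r′ + t) * (r′ ⊓ t)) ⊔ (2 * r′ * σ * (r′ ⊓ t))) * 2 ^ (ρ₂₄ * t * r′)

RadicalBounds : (r s t R N C : ℕ) → Set
RadicalBounds r s t R N C = BoundI (r ⊓ s) t R C × BoundII (r ⊓ s) t R N C
  × BoundIII (r ⊓ s) (r ⊔ s) t R N C
  × BoundIV (6 * r * s) (3 * r * s) (24 * r * s) (s * t + r * t + r * s) (r ⊓ s) t R N C

RadicalBounds-swap : ∀ {r s t R N C} → RadicalBounds s r t R N C → RadicalBounds r s t R N C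
RadicalBounds-swap {r} {s} {t} {R} {N} {C} (i , ii , iii , iv) =
  subst (λ r′ → BoundI r′ t R C) s⊓r≡r⊓s i ,
  subst (λ r′ → BoundII r′ t R N C) s⊓r≡r⊓s ii ,
  subst₂ (λ r′ s′ → BoundIII r′ s′ t R N C) s⊓r≡r⊓s (⊔-comm s r) iii ,
  subst (λ σ → BoundIV (6 * r * s) (3 * r * s) (24 * r * s) σ (r ⊓ s) t R N C) σ-comm
    (subst₂ (λ ρ₂₄ r′ → BoundIV (6 * r * s) (3 * r * s) ρ₂₄ (r * t + s * t + s * r) r′ t R N C)
      (*-right-comm 24 s r) s⊓r≡r⊓s
      (subst₂ (λ ρ₆ ρ₃ → BoundIV ρ₆ ρ₃ (24 * s * r) (r * t + s * t + s * r) (s ⊓ r) t R N C)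
        (*-right-comm 6 s r) (*-right-comm 3 s r) iv))
  where
  s⊓r≡r⊓s : s ⊓ r ≡ r ⊓ s
  s⊓r≡r⊓s = ⊓-comm s r
  σ-comm : r * t + s * t + s * r ≡ s * t + r * t + r * s
  σ-comm = cong₂ _+_ (+-comm (r * t) (s * t)) (*-comm s r)

module Bounds {r s t a b c N C pa pb pc : ℕ}
  (r≤s : r ≤ s) (1≤t : 1 ≤ t) (1≤N : 1 ≤ N)
  (a+b≡c : a + b ≡ c) (1≤a : 1 ≤ a) (1≤b : 1 ≤ b) (abc≤16N : a * b * c ≤ N * 16)
  (1≤pa : 1 ≤ pa) (1≤pb : 1 ≤ pb) (1≤pc : 1 ≤ pc)
  (pa^r≤a : pa ^ r ≤ a) (pb^s≤b : pb ^ s ≤ b) (pc^t≤c : pc ^ t ≤ c)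
  (T≤16C : pa ^ r * pb ^ s * pc ^ t ≤ C * 16)
  -- when r = t, a is a t-th power, and power-gap-^ applies
  (r≡t⇒gap : r ≡ t → c ^ (t ∸ 1) ≤ b ^ t)
  where

  R : ℕ
  R = pa * pb * pc

  radical-bound : ∀ {E K La Lb Lc} → E ≤ r * (K + La) → E ≤ s * (K + Lb) → E ≤ t * (K + Lc) →
    R ^ E ≤ (C * 16) ^ K * (a ^ La * b ^ Lb * c ^ Lc)
  radical-bound {E} {K} {La} {Lb} {Lc} Ea Eb Ec = begin
    R ^ E                                 ≡⟨ ^-distribʳ-*³ pa pb pc E ⟩
    pa ^ E * pb ^ E * pc ^ E
      ≤⟨ *-mono-≤ (*-mono-≤ (^-split-≤ pa {r} {K} 1≤pa Ea) (^-split-≤ pb {s} {K} 1≤pb Eb)) (^-split-≤ pc {t} {K} 1≤pc Ec) ⟩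
    A ^ K * A ^ La * (B ^ K * B ^ Lb) * (Γ ^ K * Γ ^ Lc)
      ≡⟨ regroup (A ^ K) (A ^ La) (B ^ K) (B ^ Lb) (Γ ^ K) (Γ ^ Lc) ⟩
    A ^ K * B ^ K * Γ ^ K * (A ^ La * B ^ Lb * Γ ^ Lc)
      ≡⟨ cong (_* (A ^ La * B ^ Lb * Γ ^ Lc)) (^-distribʳ-*³ A B Γ K) ⟨
    (A * B * Γ) ^ K * (A ^ La * B ^ Lb * Γ ^ Lc)
      ≤⟨ *-mono-≤ (^-monoˡ-≤ K T≤16C) (*-mono-≤ (*-mono-≤ (^-monoˡ-≤ La pa^r≤a) (^-monoˡ-≤ Lb pb^s≤b)) (^-monoˡ-≤ Lc pc^t≤c)) ⟩
    (C * 16) ^ K * (a ^ La * b ^ Lb * c ^ Lc) ∎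
    where
    open ≤-Reasoning
    A B Γ : ℕ
    A = pa ^ r
    B = pb ^ s
    Γ = pc ^ t
    regroup : ∀ x x′ y y′ z z′ → x * x′ * (y * y′) * (z * z′) ≡ x * y * z * (x′ * y′ * z′)
    regroup = solve-∀

  combine : ∀ E K L M {W} → R ^ E ≤ (C * 16) ^ K * W → W ≤ N ^ L * 2 ^ M →
    R ^ E * N ^ K ≤ C ^ K * N ^ (L + K) * 2 ^ (4 * K + M)
  combine E K L M {W} R^E≤ W≤ = begin
    R ^ E * N ^ K
      ≤⟨ *-monoˡ-≤ (N ^ K) (≤-trans R^E≤ (*-monoʳ-≤ ((C * 16) ^ K) W≤)) ⟩
    (C * 16) ^ K * (N ^ L * 2 ^ M) * N ^ K
      ≡⟨ cong (λ x → x * (N ^ L * 2 ^ M) * N ^ K) (trans (^-distribʳ-* C 16 K) (cong (C ^ K *_) (^-*-assoc 2 4 K))) ⟩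
    C ^ K * 2 ^ (4 * K) * (N ^ L * 2 ^ M) * N ^ K
      ≡⟨ regroup (C ^ K) (2 ^ (4 * K)) (N ^ L) (2 ^ M) (N ^ K) ⟩
    C ^ K * (N ^ L * N ^ K) * (2 ^ (4 * K) * 2 ^ M)
      ≡⟨ cong₂ (λ x y → C ^ K * x * y) (^-distribˡ-+-* N L K) (^-distribˡ-+-* 2 (4 * K) M) ⟨
    C ^ K * N ^ (L + K) * 2 ^ (4 * K + M) ∎
    where
    open ≤-Reasoning
    regroup : ∀ x y u v w → x * y * (u * v) * w ≡ x * (u * w) * (y * v)
    regroup = solve-∀

  part-i : BoundI r t R C
  part-i = begin
    R ^ (r ⊓ t)         ≤⟨ radical-bound {K = 1} {0} {0} {0} (≤-trans (m⊓n≤m r t) (≤-reflexive (sym (*-identityʳ r))))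
                                                          (≤-trans (≤-trans (m⊓n≤m r t) r≤s) (≤-reflexive (sym (*-identityʳ s))))
                                                          (≤-trans (m⊓n≤n r t) (≤-reflexive (sym (*-identityʳ t)))) ⟩
    (C * 16) ^ 1 * 1    ≡⟨ trans (*-identityʳ _) (*-identityʳ (C * 16)) ⟩
    C * 16              ∎
    where open ≤-Reasoning

  a≤c : a ≤ c
  a≤c = subst (a ≤_) a+b≡c (m≤m+n a b)

  b≤c : b ≤ c
  b≤c = subst (b ≤_) a+b≡c (m≤n+m b a)

  [16N]^n≡N^n*2^[4n] : ∀ n → (N * 16) ^ n ≡ N ^ n * 2 ^ (4 * n)
  [16N]^n≡N^n*2^[4n] n = trans (^-distribʳ-* N 16 n) (cong (N ^ n *_) (^-*-assoc 2 4 n))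

  c*c≤32N : c * c ≤ N * 2 ^ 5
  c*c≤32N = begin
    c * c             ≤⟨ c*c≤2*abc a+b≡c 1≤a 1≤b ⟩
    2 * (a * b * c)   ≤⟨ *-monoʳ-≤ 2 abc≤16N ⟩
    2 * (N * 16)      ≡⟨ trans (*-comm 2 (N * 16)) (*-assoc N 16 2) ⟩
    N * 32            ∎
    where open ≤-Reasoning

  part-ii : BoundII r t R N C
  part-ii t≤r rewrite m≥n⇒m⊓n≡n t≤r with m≤n⇒∃[o]m+o≡n t≤r
  ... | d , refl = bound-weaken (2 * t * t) 1≤N (≤-reflexive (N-exponent t d)) 2-exponent
    (^-*-bound t (2 * t * (t + d)) (2 * t) (2 * t) (d + 2 * t) (4 * (2 * t) + 5 * d) base)
    where
    Ea : ∀ t d → 2 * t * (t + d) ≡ (t + d) * (2 * t + 0)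
    Ea = solve-∀
    Eb : ∀ t s → 2 * t * s ≡ s * (2 * t + 0)
    Eb = solve-∀
    Ec : ∀ t d → 2 * t * (t + d) ≡ t * (2 * t + 2 * d)
    Ec = solve-∀
    W≤ : a ^ 0 * b ^ 0 * c ^ (2 * d) ≤ N ^ d * 2 ^ (5 * d)
    W≤ = begin
      1 * c ^ (2 * d)          ≡⟨ *-identityˡ (c ^ (2 * d)) ⟩
      c ^ (2 * d)              ≡⟨ trans (cong (λ x → (c * x) ^ d) (sym (*-identityʳ c))) (^-*-assoc c 2 d) ⟨
      (c * c) ^ d              ≤⟨ ^-monoˡ-≤ d c*c≤32N ⟩
      (N * 2 ^ 5) ^ d          ≡⟨ trans (^-distribʳ-* N (2 ^ 5) d) (cong (N ^ d *_) (^-*-assoc 2 5 d)) ⟩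
      N ^ d * 2 ^ (5 * d)      ∎
      where open ≤-Reasoning
    base : R ^ (2 * t * (t + d)) * N ^ (2 * t) ≤ C ^ (2 * t) * N ^ (d + 2 * t) * 2 ^ (4 * (2 * t) + 5 * d)
    base = combine (2 * t * (t + d)) (2 * t) d (5 * d) (radical-bound {K = 2 * t} {0} {0} {2 * d} (≤-reflexive (Ea t d))
      (≤-trans (*-monoʳ-≤ (2 * t) r≤s) (≤-reflexive (Eb t s))) (≤-reflexive (Ec t d))) W≤
    N-exponent : ∀ t d → (d + 2 * t) * t ≡ (t + d + t) * t
    N-exponent = solve-∀
    2-exponent : (4 * (2 * t) + 5 * d) * t ≤ 8 * t * (t + d)
    2-exponent = ≤-trans (*-monoˡ-≤ t (+-monoʳ-≤ (4 * (2 * t)) (*-monoˡ-≤ d (m≤m+n 5 3))))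
                         (≤-reflexive (identity t d))
      where
      identity : ∀ t d → (4 * (2 * t) + 8 * d) * t ≡ 8 * t * (t + d)
      identity = solve-∀

  part-iii : BoundIII r s t R N C
  part-iii refl rewrite ⊓-idem t with m≤n⇒∃[o]m+o≡n r≤s
  ... | D , refl = bound-weaken (t * q * t) 1≤N N-exponent 2-exponent
    (^-*-bound t ((t + D) * t * q) (t * q) (t * q) (2 * t * D + t * q) (4 * (t * q) + 4 * (2 * t * D)) base)
    where
    q : ℕ
    q = 3 * t ∸ 1
    q≡2t+[t∸1] : q ≡ 2 * t + (t ∸ 1)
    q≡2t+[t∸1] = 3*t∸1≡2*t+[t∸1] t 1≤t
    2t≤q : 2 * t ≤ q
    2t≤q = ≤-trans (m≤m+n (2 * t) (t ∸ 1)) (≤-reflexive (sym q≡2t+[t∸1]))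
    q≤4t : q ≤ 4 * t
    q≤4t = ≤-trans (m∸n≤m (3 * t) 1) (*-monoˡ-≤ t (m≤m+n 3 1))
    Ea : ∀ t D q → (t + D) * t * q ≡ t * (t * q + D * q)
    Ea = solve-∀
    Eb : ∀ s t q → s * t * q ≡ s * (t * q + 0)
    Eb = solve-∀
    W≤ : a ^ (D * q) * b ^ 0 * c ^ (D * q) ≤ N ^ (2 * t * D) * 2 ^ (4 * (2 * t * D))
    W≤ = begin
      a ^ (D * q) * 1 * c ^ (D * q)  ≡⟨ cong (_* c ^ (D * q)) (*-identityʳ (a ^ (D * q))) ⟩
      a ^ (D * q) * c ^ (D * q)      ≡⟨ ^-distribʳ-* a c (D * q) ⟨
      (a * c) ^ (D * q)              ≡⟨ trans (cong ((a * c) ^_) (*-comm D q)) (sym (^-*-assoc (a * c) q D)) ⟩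
      ((a * c) ^ q) ^ D              ≤⟨ ^-monoˡ-≤ D (subst (λ e → (a * c) ^ e ≤ (a * b * c) ^ (2 * t)) (sym q≡2t+[t∸1])
                                          ([ac]^[2m+k]≤[abc]^2m t (t ∸ 1) a≤c (r≡t⇒gap refl))) ⟩
      ((a * b * c) ^ (2 * t)) ^ D    ≤⟨ ^-monoˡ-≤ D (^-monoˡ-≤ (2 * t) abc≤16N) ⟩
      ((N * 16) ^ (2 * t)) ^ D       ≡⟨ ^-*-assoc (N * 16) (2 * t) D ⟩
      (N * 16) ^ (2 * t * D)         ≡⟨ [16N]^n≡N^n*2^[4n] (2 * t * D) ⟩
      N ^ (2 * t * D) * 2 ^ (4 * (2 * t * D)) ∎
      where open ≤-Reasoning
    base : R ^ ((t + D) * t * q) * N ^ (t * q)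
      ≤ C ^ (t * q) * N ^ (2 * t * D + t * q) * 2 ^ (4 * (t * q) + 4 * (2 * t * D))
    base = combine ((t + D) * t * q) (t * q) (2 * t * D) (4 * (2 * t * D))
      (radical-bound {K = t * q} {D * q} {0} {D * q} (≤-reflexive (Ea t D q)) (≤-reflexive (Eb (t + D) t q))
        (≤-reflexive (Ea t D q))) W≤
    N-exponent : (2 * t * D + t * q) * t ≤ 2 * t * ((t + D) + t) * t
    N-exponent = ≤-trans (*-monoˡ-≤ t (+-monoʳ-≤ (2 * t * D) (*-monoʳ-≤ t q≤4t))) (≤-reflexive (identity t D))
      where
      identity : ∀ t D → (2 * t * D + t * (4 * t)) * t ≡ 2 * t * ((t + D) + t) * t
      identity = solve-∀
    2-exponent : (4 * (t * q) + 4 * (2 * t * D)) * t ≤ 4 * (t + D) * t * q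
    2-exponent = ≤-trans (*-monoˡ-≤ t (+-monoʳ-≤ (4 * (t * q)) (*-monoʳ-≤ 4 (*-monoˡ-≤ D 2t≤q))))
                         (≤-reflexive (identity t D q))
      where
      identity : ∀ t D q → (4 * (t * q) + 4 * (q * D)) * t ≡ 4 * (t + D) * t * q
      identity = solve-∀

  part-iv : BoundIV (6 * r * s) (3 * r * s) (24 * r * s) (s * t + r * t + r * s) r t R N C
  part-iv r≤t rewrite m≤n⇒m⊓n≡m r≤t with m≤n⇒∃[o]m+o≡n r≤t
  ... | j , refl = [ small-Y , large-Y ]′ (≤-<-connex (2 * Y) X)
    where
    k X Y E K P Q : ℕ
    k = (r + j) ∸ s
    X = s * j
    Y = r * k
    E = 6 * r * s * (r + j)
    K = 6 * r * s
    P = 3 * r * s * (r + (r + j)) * r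
    Q = 2 * r * (s * (r + j) + r * (r + j) + r * s) * r
    Goal : Set
    Goal = R ^ (E * r * r) * N ^ (K * r * r) ≤ C ^ (K * r * r) * N ^ (P ⊔ Q) * 2 ^ (24 * r * s * (r + j) * r)

    Ea : E ≡ r * (K + 6 * X)
    Ea = identity r s j
      where
      identity : ∀ r s j → 6 * r * s * (r + j) ≡ r * (6 * r * s + 6 * (s * j))
      identity = solve-∀
    Eb : E ≤ s * (K + 6 * Y)
    Eb = ≤-trans (*-monoʳ-≤ K (m≤n+m∸n (r + j) s)) (≤-reflexive (identity r s k))
      where
      identity : ∀ r s k → 6 * r * s * (s + k) ≡ s * (6 * r * s + 6 * (r * k))
      identity = solve-∀
    Ec : E ≡ (r + j) * (K + 0)
    Ec = identity (6 * r * s) (r + j)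
      where
      identity : ∀ x t → x * t ≡ t * (x + 0)
      identity = solve-∀

    finish : ∀ L M → a ^ (6 * X) * b ^ (6 * Y) * c ^ 0 ≤ N ^ L * 2 ^ M →
      (L + K) * r * r ≤ P ⊔ Q → (4 * K + M) * r * r ≤ 24 * r * s * (r + j) * r → Goal
    finish L M W≤ N-exponent 2-exponent = bound-weaken (K * r * r) 1≤N N-exponent 2-exponent
      (^-*-bound r (E * r) (K * r) (K * r) ((L + K) * r) ((4 * K + M) * r)
        (^-*-bound r E K K (L + K) (4 * K + M)
          (combine E K L M (radical-bound {K = K} {6 * X} {6 * Y} {0} (≤-reflexive Ea) Eb (≤-reflexive Ec)) W≤)))

    2-exponent : ∀ {M} → M ≤ 4 * (6 * X) → (4 * K + M) * r * r ≤ 24 * r * s * (r + j) * r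
    2-exponent M≤ = ≤-trans (*-monoˡ-≤ r (*-monoˡ-≤ r (+-monoʳ-≤ (4 * K) M≤))) (≤-reflexive (identity r s j))
      where
      identity : ∀ r s j → (4 * (6 * r * s) + 4 * (6 * (s * j))) * r * r ≡ 24 * r * s * (r + j) * r
      identity = solve-∀

    small-Y : 2 * Y ≤ X → Goal
    small-Y 2Y≤X = finish (3 * X) (4 * (3 * X)) W≤ (≤-trans (≤-reflexive (identity r s j)) (m≤m⊔n P Q))
                          (2-exponent (*-monoʳ-≤ 4 (*-monoˡ-≤ X (m≤m+n 3 3))))
      where
      identity : ∀ r s j → (3 * (s * j) + 6 * r * s) * r * r ≡ 3 * r * s * (r + (r + j)) * r
      identity = solve-∀
      W≤ : a ^ (6 * X) * b ^ (6 * Y) * c ^ 0 ≤ N ^ (3 * X) * 2 ^ (4 * (3 * X))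
      W≤ = begin
        a ^ (6 * X) * b ^ (6 * Y) * 1     ≡⟨ *-identityʳ _ ⟩
        a ^ (6 * X) * b ^ (6 * Y)         ≡⟨ cong (λ e → a ^ e * b ^ (6 * Y)) (6x≡3x+3x X) ⟩
        a ^ (3 * X + 3 * X) * b ^ (6 * Y) ≤⟨ a^[n+n]*b^m≤[abc]^n (3 * X) (6 * Y) a≤c 1≤b (≤-trans (≤-reflexive (*-assoc 3 2 Y)) (*-monoʳ-≤ 3 2Y≤X)) ⟩
        (a * b * c) ^ (3 * X)             ≤⟨ ^-monoˡ-≤ (3 * X) abc≤16N ⟩
        (N * 16) ^ (3 * X)                ≡⟨ [16N]^n≡N^n*2^[4n] (3 * X) ⟩
        N ^ (3 * X) * 2 ^ (4 * (3 * X))   ∎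
        where
        open ≤-Reasoning
        6x≡3x+3x : ∀ x → 6 * x ≡ 3 * x + 3 * x
        6x≡3x+3x = solve-∀

    -- If s > t then Y = 0, which rules out X < 2 Y; so here t = s + k exactly.
    large-Y : X < 2 * Y → Goal
    large-Y X<2Y = finish ((X + Y) * 2) (4 * ((X + Y) * 2)) W≤
                          (≤-trans (≤-reflexive N-exponent) (m≤n⊔m P Q)) (2-exponent (*-monoʳ-≤ 4 [X+Y]*2≤6X))
      where
      s≤t : s ≤ r + j
      s≤t with s ≤? r + j
      ... | yes s≤t = s≤t
      ... | no  s≰t = ⊥-elim (n≮0 (subst (λ y → X < 2 * y) (trans (cong (r *_) (m≤n⇒m∸n≡0 (<⇒≤ (≰⇒> s≰t)))) (*-zeroʳ r)) X<2Y))
      Y≤X : Y ≤ X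
      Y≤X = *-mono-≤ r≤s (≤-trans (∸-monoʳ-≤ (r + j) r≤s) (≤-reflexive (m+n∸m≡n r j)))
      [X+Y]*2≤6X : (X + Y) * 2 ≤ 6 * X
      [X+Y]*2≤6X = ≤-trans (*-monoˡ-≤ 2 (+-monoʳ-≤ X Y≤X)) (≤-trans (≤-reflexive (identity X)) (*-monoˡ-≤ X (m≤m+n 4 2)))
        where
        identity : ∀ x → (x + x) * 2 ≡ 4 * x
        identity = solve-∀
      W≤ : a ^ (6 * X) * b ^ (6 * Y) * c ^ 0 ≤ N ^ ((X + Y) * 2) * 2 ^ (4 * ((X + Y) * 2))
      W≤ = begin
        a ^ (6 * X) * b ^ (6 * Y) * 1         ≡⟨ *-identityʳ _ ⟩
        a ^ (6 * X) * b ^ (6 * Y)             ≡⟨ cong₂ _*_ (trans (cong (a ^_) (6x≡3x*2 X)) (sym (^-*-assoc a (3 * X) 2)))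
                                                         (trans (cong (b ^_) (6x≡3x*2 Y)) (sym (^-*-assoc b (3 * Y) 2))) ⟩
        (a ^ (3 * X)) ^ 2 * (b ^ (3 * Y)) ^ 2 ≡⟨ ^-distribʳ-* (a ^ (3 * X)) (b ^ (3 * Y)) 2 ⟨
        (a ^ (3 * X) * b ^ (3 * Y)) ^ 2       ≤⟨ ^-monoˡ-≤ 2 (a^3x*b^3y≤[abc]^[x+y] X Y a≤c b≤c (≤-trans Y≤X (m≤m+n X (X + 0))) (<⇒≤ X<2Y)) ⟩
        ((a * b * c) ^ (X + Y)) ^ 2           ≤⟨ ^-monoˡ-≤ 2 (^-monoˡ-≤ (X + Y) abc≤16N) ⟩
        ((N * 16) ^ (X + Y)) ^ 2              ≡⟨ ^-*-assoc (N * 16) (X + Y) 2 ⟩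
        (N * 16) ^ ((X + Y) * 2)              ≡⟨ [16N]^n≡N^n*2^[4n] ((X + Y) * 2) ⟩
        N ^ ((X + Y) * 2) * 2 ^ (4 * ((X + Y) * 2)) ∎
        where
        open ≤-Reasoning
        6x≡3x*2 : ∀ x → 6 * x ≡ 3 * x * 2
        6x≡3x*2 = solve-∀
      N-exponent : ((X + Y) * 2 + K) * r * r ≡ Q
      N-exponent = trans (identity r s j k) (cong (λ u → 2 * r * (s * (r + j) + r * u + r * s) * r) (m+[n∸m]≡n s≤t))
        where
        identity : ∀ r s j k → ((s * j + r * k) * 2 + 6 * r * s) * r * r ≡ 2 * r * (s * (r + j) + r * (s + k) + r * s) * r
        identity = solve-∀

  radical-bounds : RadicalBounds r s t R N C
  radical-bounds =
    subst (λ r′ → BoundI r′ t R C) r≡r⊓s part-i ,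
    subst (λ r′ → BoundII r′ t R N C) r≡r⊓s part-ii ,
    subst₂ (λ r′ s′ → BoundIII r′ s′ t R N C) r≡r⊓s (sym (m≤n⇒m⊔n≡n r≤s)) part-iii ,
    subst (λ r′ → BoundIV (6 * r * s) (3 * r * s) (24 * r * s) (s * t + r * t + r * s) r′ t R N C) r≡r⊓s part-iv
    where
    r≡r⊓s : r ≡ r ⊓ s
    r≡r⊓s = sym (m≤n⇒m⊓n≡m r≤s)

-- Splitting the radical of N_C

module Decomposition (r s t x y z : ℕ) (S : List ℕ) (1≤x : 1 ≤ x) (1≤y : 1 ≤ y) (1≤z : 1 ≤ z) where

  a b c : ℕ
  a = x ^ r
  b = y ^ s
  c = z ^ t

  N : ℕ
  N = Nof (a * b * c)

  C : ℕ
  C = NC S N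

  1≤a : 1 ≤ a
  1≤a = 1≤m^n x r 1≤x

  1≤b : 1 ≤ b
  1≤b = 1≤m^n y s 1≤y

  1≤c : 1 ≤ c
  1≤c = 1≤m^n z t 1≤z

  abc≡N*g : a * b * c ≡ N * gcd 16 (a * b * c)
  abc≡N*g = m∣n⇒n≡quotient*m (gcd[m,n]∣n 16 (a * b * c))

  abc≤16N : a * b * c ≤ N * 16
  abc≤16N = ≤-trans (≤-reflexive abc≡N*g) (*-monoʳ-≤ N (∣⇒≤ (gcd[m,n]∣m 16 (a * b * c))))

  abc∣16N : a * b * c ∣ N * 16
  abc∣16N = subst (_∣ N * 16) (sym abc≡N*g) (*-monoʳ-∣ N (gcd[m,n]∣m 16 (a * b * c)))

  1≤N : 1 ≤ N
  1≤N = n≢0⇒n>0 λ N≡0 → <⇒≱ (*-mono-≤ (*-mono-≤ 1≤a 1≤b) 1≤c)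
    (≤-reflexive (trans abc≡N*g (cong (_* gcd 16 (a * b * c)) N≡0)))

  1≤C : 1 ≤ C
  1≤C = 1≤∏p^e (λ p → v p N) (Cset S N) (All.map proj₁ (Cset-InC S N))

  prime∣C⇒prime∣abc : ∀ {q} → Prime q → q ∣ C → q ∣ a * b * c
  prime∣C⇒prime∣abc pq q∣C = ∣-trans (prime∣NC⇒prime∣N S N pq q∣C)
    (divides (gcd 16 (a * b * c)) (trans abc≡N*g (*-comm N (gcd 16 (a * b * c)))))

  prime∣C⇒prime∣z : ∀ {q} → Prime q → q ∣ C → ¬ q ∣ x → ¬ q ∣ y → q ∣ z
  prime∣C⇒prime∣z pq q∣C q∤x q∤y with euclidsLemma (a * b) c pq (prime∣C⇒prime∣abc pq q∣C)
  ... | inj₂ q∣c = prime∣m^n⇒prime∣m z t pq q∣c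
  ... | inj₁ q∣ab with euclidsLemma a b pq q∣ab
  ...   | inj₁ q∣a = ⊥-elim (q∤x (prime∣m^n⇒prime∣m x r pq q∣a))
  ...   | inj₂ q∣b = ⊥-elim (q∤y (prime∣m^n⇒prime∣m y s pq q∣b))

  prime^∣abc⇒prime^∣16C : ∀ {q} k → Prime q → q ∣ C → q ^ k ∣ a * b * c → q ^ k ∣ C * 16
  prime^∣abc⇒prime^∣16C k pq q∣C q^k∣abc = prime^∣N*16⇒prime^∣NC*16 S N {j = k} pq q∣C 1≤N (∣-trans q^k∣abc abc∣16N)

  exponent : ℕ → ℕ
  exponent q with q ∣? x
  ... | yes _ = r
  ... | no  _ with q ∣? y
  ...   | yes _ = s
  ...   | no  _ = t

  exponent-x : ∀ {q} → q ∣ x → exponent q ≡ r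
  exponent-x {q} q∣x with q ∣? x
  ... | yes _   = refl
  ... | no  q∤x = ⊥-elim (q∤x q∣x)

  exponent-y : ∀ {q} → ¬ q ∣ x → q ∣ y → exponent q ≡ s
  exponent-y {q} q∤x q∣y with q ∣? x
  ... | yes q∣x = ⊥-elim (q∤x q∣x)
  ... | no  _ with q ∣? y
  ...   | yes _   = refl
  ...   | no  q∤y = ⊥-elim (q∤y q∣y)

  exponent-z : ∀ {q} → ¬ q ∣ x → ¬ q ∣ y → exponent q ≡ t
  exponent-z {q} q∤x q∤y with q ∣? x
  ... | yes q∣x = ⊥-elim (q∤x q∣x)
  ... | no  _ with q ∣? y
  ...   | yes q∣y = ⊥-elim (q∤y q∣y)
  ...   | no  _   = refl

  prime^exponent∣16C : ∀ {q} → Prime q → q ∣ C → q ^ exponent q ∣ C * 16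
  prime^exponent∣16C {q} pq q∣C with q ∣? x
  ... | yes q∣x = prime^∣abc⇒prime^∣16C r pq q∣C (∣-trans (^-monoˡ-∣ r q∣x) (∣m⇒∣m*n c (m∣m*n b)))
  ... | no  q∤x with q ∣? y
  ...   | yes q∣y = prime^∣abc⇒prime^∣16C s pq q∣C (∣-trans (^-monoˡ-∣ s q∣y) (∣m⇒∣m*n c (n∣m*n a)))
  ...   | no  q∤y = prime^∣abc⇒prime^∣16C t pq q∣C (∣-trans (^-monoˡ-∣ t (prime∣C⇒prime∣z pq q∣C q∤x q∤y)) (n∣m*n (a * b)))

  Q Q¬x Qx Qy Qz : List ℕ
  Q   = primeDivisors C
  Qx  = filter (_∣? x) Q
  Q¬x = filter (¬? ∘ (_∣? x)) Q
  Qy  = filter (_∣? y) Q¬x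
  Qz  = filter (¬? ∘ (_∣? y)) Q¬x

  pa pb pc : ℕ
  pa = product Qx
  pb = product Qy
  pc = product Qz

  rad≡pa*pb*pc : rad C ≡ pa * pb * pc
  rad≡pa*pb*pc = trans (product-filter (_∣? x) Q)
    (trans (cong (pa *_) (product-filter (_∣? y) Q¬x)) (sym (*-assoc pa pb pc)))

  Q-prime : All Prime Q
  Q-prime = All.map proj₁ (primeDivisors-prime∣ C)

  Q¬x-prime : All Prime Q¬x
  Q¬x-prime = filter⁺ (¬? ∘ (_∣? x)) Q-prime

  Q¬x-unique : Unique Q¬x
  Q¬x-unique = Unique.filter⁺ (¬? ∘ (_∣? x)) (primeDivisors-unique C)

  Qz-prime : All Prime Qz
  Qz-prime = filter⁺ (¬? ∘ (_∣? y)) Q¬x-prime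

  pa∣x : pa ∣ x
  pa∣x = ∏-primes-∣ Qx (Unique.filter⁺ (_∣? x) (primeDivisors-unique C)) (filter⁺ (_∣? x) Q-prime) (all-filter (_∣? x) Q)

  pb∣y : pb ∣ y
  pb∣y = ∏-primes-∣ Qy (Unique.filter⁺ (_∣? y) Q¬x-unique) (filter⁺ (_∣? y) Q¬x-prime) (all-filter (_∣? y) Q¬x)

  Qz-∤x : All (λ q → ¬ q ∣ x) Qz
  Qz-∤x = filter⁺ (¬? ∘ (_∣? y)) (all-filter (¬? ∘ (_∣? x)) Q)

  Qz-∤y : All (λ q → ¬ q ∣ y) Qz
  Qz-∤y = all-filter (¬? ∘ (_∣? y)) Q¬x

  pc∣z : pc ∣ z
  pc∣z = ∏-primes-∣ Qz (Unique.filter⁺ (¬? ∘ (_∣? y)) Q¬x-unique) Qz-prime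
    (All.zipWith (λ { ((pq , q∣C) , q∤x , q∤y) → prime∣C⇒prime∣z pq q∣C q∤x q∤y })
      (filter⁺ (¬? ∘ (_∣? y)) (filter⁺ (¬? ∘ (_∣? x)) (primeDivisors-prime∣ C)) , All.zip (Qz-∤x , Qz-∤y)))

  1≤pa : 1 ≤ pa
  1≤pa = productOfPrimes≥1 (filter⁺ (_∣? x) Q-prime)

  1≤pb : 1 ≤ pb
  1≤pb = productOfPrimes≥1 (filter⁺ (_∣? y) Q¬x-prime)

  1≤pc : 1 ≤ pc
  1≤pc = productOfPrimes≥1 Qz-prime

  ∏q^exponent≡pa^r*pb^s*pc^t : product (map (λ q → q ^ exponent q) Q) ≡ pa ^ r * pb ^ s * pc ^ t
  ∏q^exponent≡pa^r*pb^s*pc^t = begin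
    product (map f Q)
      ≡⟨ product-map-filter (_∣? x) f Q ⟩
    product (map f Qx) * product (map f Q¬x)
      ≡⟨ cong (product (map f Qx) *_) (product-map-filter (_∣? y) f Q¬x) ⟩
    product (map f Qx) * (product (map f Qy) * product (map f Qz))
      ≡⟨ cong₂ _*_ part-x (cong₂ _*_ part-y part-z) ⟩
    pa ^ r * (pb ^ s * pc ^ t)
      ≡⟨ *-assoc (pa ^ r) (pb ^ s) (pc ^ t) ⟨
    pa ^ r * pb ^ s * pc ^ t ∎
    where
    open ≡-Reasoning
    f : ℕ → ℕ
    f q = q ^ exponent q
    part-x : product (map f Qx) ≡ pa ^ r
    part-x = trans (product-map-cong (All.map (λ {q} q∣x → cong (q ^_) (exponent-x q∣x)) (all-filter (_∣? x) Q)))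
                   (product-map-^ r Qx)
    part-y : product (map f Qy) ≡ pb ^ s
    part-y = trans (product-map-cong (All.zipWith (λ {q} (q∤x , q∣y) → cong (q ^_) (exponent-y q∤x q∣y))
                     (filter⁺ (_∣? y) (all-filter (¬? ∘ (_∣? x)) Q) , all-filter (_∣? y) Q¬x)))
                   (product-map-^ s Qy)
    part-z : product (map f Qz) ≡ pc ^ t
    part-z = trans (product-map-cong (All.zipWith (λ {q} (q∤x , q∤y) → cong (q ^_) (exponent-z q∤x q∤y)) (Qz-∤x , Qz-∤y)))
                   (product-map-^ t Qz)

  pa^r*pb^s*pc^t≤16C : pa ^ r * pb ^ s * pc ^ t ≤ C * 16
  pa^r*pb^s*pc^t≤16C = ∣⇒≤ {{>-nonZero (*-mono-≤ 1≤C (s≤s z≤n))}} (subst (_∣ C * 16) ∏q^exponent≡pa^r*pb^s*pc^t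
    (∏p^e-∣ exponent Q (primeDivisors-unique C) Q-prime
      (All.map (λ (pq , q∣C) → prime^exponent∣16C pq q∣C) (primeDivisors-prime∣ C))))

  pa^r≤a : pa ^ r ≤ a
  pa^r≤a = ∣⇒≤ {{>-nonZero 1≤a}} (^-monoˡ-∣ r pa∣x)

  pb^s≤b : pb ^ s ≤ b
  pb^s≤b = ∣⇒≤ {{>-nonZero 1≤b}} (^-monoˡ-∣ s pb∣y)

  pc^t≤c : pc ^ t ≤ c
  pc^t≤c = ∣⇒≤ {{>-nonZero 1≤c}} (^-monoˡ-∣ t pc∣z)

lemma4p2 : (r s t x y z : ℕ) → 2 ≤ r → 2 ≤ s → 2 ≤ t
  → 1 ≤ x → 1 ≤ y → 1 ≤ z → gcd x (gcd y z) ≡ 1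
  → x ^ r + y ^ s ≡ z ^ t
  → (S : List ℕ) → Unique S → All Prime S → All (λ p → 11 ≤ p) S → 2 ≤ length S
  → let N = Nof (x ^ r * y ^ s * z ^ t)
        NC' = NC S N
        R = rad NC'
        u₀ = r ⊓ s ⊓ t
        r′ = r ⊓ s
        s′ = r ⊔ s
    in (R ^ u₀ ≤ NC' * 2 ^ 4)
     × (t ≤ r′ → R ^ (2 * t * r′ * u₀) * N ^ (2 * t * u₀)
          ≤ NC' ^ (2 * t * u₀) * N ^ ((r′ + t) * u₀) * 2 ^ (8 * t * r′))
     × (t ≡ r′ → R ^ (s′ * t * (3 * t ∸ 1) * u₀) * N ^ (t * (3 * t ∸ 1) * u₀)
          ≤ NC' ^ (t * (3 * t ∸ 1) * u₀) * N ^ (2 * t * (s′ + t) * u₀)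
            * 2 ^ (4 * s′ * t * (3 * t ∸ 1)))
     × (r′ ≤ t → R ^ (6 * r * s * t * r′ * u₀) * N ^ (6 * r * s * r′ * u₀)
          ≤ NC' ^ (6 * r * s * r′ * u₀)
            * N ^ ((3 * r * s * (r′ + t) * u₀) ⊔ (2 * r′ * (s * t + r * t + r * s) * u₀))
            * 2 ^ (24 * r * s * t * r′))
lemma4p2 r s t x y z _ _ 2≤t 1≤x 1≤y 1≤z _ x^r+y^s≡z^t S _ _ _ _ with r ≤? s
... | yes r≤s = subst (λ R → RadicalBounds r s t R N C) (sym rad≡pa*pb*pc)
  (Bounds.radical-bounds r≤s 1≤t 1≤N x^r+y^s≡z^t 1≤a 1≤b abc≤16N 1≤pa 1≤pb 1≤pc
    pa^r≤a pb^s≤b pc^t≤c pa^r*pb^s*pc^t≤16C (λ { refl → power-gap-^ t 1≤t 1≤b x^r+y^s≡z^t }))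
  where
  open Decomposition r s t x y z S 1≤x 1≤y 1≤z
  1≤t : 1 ≤ t
  1≤t = <⇒≤ 2≤t
... | no r≰s = RadicalBounds-swap (subst (λ R → RadicalBounds s r t R N C) (sym rad≡pb*pa*pc)
  (Bounds.radical-bounds (<⇒≤ (≰⇒> r≰s)) 1≤t 1≤N y^s+x^r≡z^t 1≤b 1≤a bac≤16N 1≤pb 1≤pa 1≤pc
    pb^s≤b pa^r≤a pc^t≤c pb^s*pa^r*pc^t≤16C (λ { refl → power-gap-^ t 1≤t 1≤a y^s+x^r≡z^t })))
  where
  open Decomposition r s t x y z S 1≤x 1≤y 1≤z
  1≤t : 1 ≤ t
  1≤t = <⇒≤ 2≤t
  y^s+x^r≡z^t : y ^ s + x ^ r ≡ z ^ t
  y^s+x^r≡z^t = trans (+-comm b a) x^r+y^s≡z^t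
  bac≤16N : b * a * c ≤ N * 16
  bac≤16N = subst (_≤ N * 16) (cong (_* c) (*-comm a b)) abc≤16N
  pb^s*pa^r*pc^t≤16C : pb ^ s * pa ^ r * pc ^ t ≤ C * 16
  pb^s*pa^r*pc^t≤16C = subst (_≤ C * 16) (cong (_* pc ^ t) (*-comm (pa ^ r) (pb ^ s))) pa^r*pb^s*pc^t≤16C
  rad≡pb*pa*pc : rad C ≡ pb * pa * pc
  rad≡pb*pa*pc = trans rad≡pa*pb*pc (cong (_* pc) (*-comm pa pb))
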